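{- Let $s\ge0$ be an integer and let $G$ be a graph such that $G$ is not an $s$-star, but $G\setminus v$ is an $s$-star for every $v\in V(G)$. Then $|V(G)|\le 4s+5$.
   Context: In a graph $G$, a set $X\subseteq V(G)$ is a crown if every vertex $v\in V(G)$ is either adjacent to every vertex of $X\setminus\{v\}$ or adjacent to no vertex of $X\setminus\{v\}$ (in particular $G[X]$ is complete or edgeless). A set $S\subseteq V(G)$ is a core if $V(G)\setminus S$ is a crown. $G$ is an $s$-star if it has a core of size at most $s$. -}

module Defs where

open import Data.Nat using (ℕ; suc; _≤_)
open import Data.Fin using (Fin; punchIn)
open import Data.Fin.Subset using (Subset; _∈_; ∣_∣; ∁)
open import Data.Bool using (Bool; true; false)
open import Data.Product using (Σ; _×_)
open import Data.Sum using (_⊎_)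
open import Relation.Binary.PropositionalEquality using (_≡_; _≢_)

record Graph (n : ℕ) : Set where
  field
    adj   : Fin n → Fin n → Bool
    sym   : ∀ u v → adj u v ≡ adj v u
    irrefl : ∀ v → adj v v ≡ false

open Graph public

deleteVertex : ∀ {n} → Graph (suc n) → Fin (suc n) → Graph n
deleteVertex G v = record
  { adj    = λ a b → adj G (punchIn v a) (punchIn v b)
  ; sym    = λ a b → sym G (punchIn v a) (punchIn v b)
  ; irrefl = λ a → irrefl G (punchIn v a)
  }

IsCrown : ∀ {n} → Graph n → Subset n → Set
IsCrown {n} G X = (v : Fin n) →
    ((x : Fin n) → x ∈ X → x ≢ v → adj G v x ≡ true)
  ⊎ ((x : Fin n) → x ∈ X → x ≢ v → adj G v x ≡ false)

IsCore : ∀ {n} → Graph n → Subset n → Set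
IsCore G S = IsCrown G (∁ S)

IsStar : ∀ {n} → ℕ → Graph n → Set
IsStar {n} s G = Σ (Subset n) (λ S → ∣ S ∣ ≤ s × IsCore G S)

open import Data.Unit using (⊤)

EveryDeletionStar : ∀ {n} → ℕ → Graph n → Set
EveryDeletionStar {ℕ.zero}  s G = ⊤
EveryDeletionStar {suc n}   s G = (v : Fin (suc n)) → IsStar s (deleteVertex G v)

module Submission where

-- Lifting a small core of
-- each G ∖ u back to G and adding u gives a "closed core" K u ∋ u with |K u| ≤ s + 1, such
-- that every vertex y ≠ u is adjacent to all or to none of the vertices outside K u (other
-- than y).  If n ≥ 3s + 5, fix a vertex w.  More than 2(s + 1) vertices lie outside K w, so
-- double counting yields u, v outside K w and outside each other's closed cores; at most
-- 3(s + 1) vertices lie in K u ∪ K v ∪ K w, so two distinct vertices c, d lie outside all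
-- three.  Using c and d as reference vertices one checks that the vertices outside K u or
-- outside K v are treated uniformly by every vertex of G (for u and v themselves this uses
-- K w), so K u ∖ {u} is a core of G of size at most s — a contradiction.  Thus n ≤ 3s + 4,
-- which implies the claimed n ≤ 4s + 5.

open import Defs renaming (sym to adj-sym)
open import Data.Nat using (ℕ; zero; suc; _+_; _*_; _∸_; _≤_; _<_; s≤s; z≤n; >-nonZero)
open import Data.Nat.Properties
  using ( ≤-trans; ≤-reflexive; ≤-<-trans; <-trans; ≤-pred; n<1+n; n≤1+n; <⇒≱; ≮⇒≥
        ; +-comm; +-assoc; +-suc; +-mono-≤; +-monoʳ-≤; +-cancelʳ-<; m∸n+n≡m
        ; *-monoˡ-≤; *-monoʳ-≤; *-cancelˡ-≤; *-distribˡ-+; +-*-semiring; module ≤-Reasoning )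
open import Data.Nat.Tactic.RingSolver using (solve-∀)
open import Data.Bool using (true; false; if_then_else_)
open import Data.Fin using (Fin; zero; suc; punchIn; punchOut; _≟_)
open import Data.Fin.Properties using (any?; punchIn-punchOut)
open import Data.Fin.Subset using (Subset; inside; outside; _∈_; _∉_; _∪_; _-_; ⁅_⁆; ⊤; ∁; ∣_∣)
open import Data.Fin.Subset.Properties
  using ( _∈?_; ∣p∣≤n; ∣p∣≤∣x∷p∣; ∣⊤∣≡n; ∣⁅x⁆∣≡1; ∣∁p∣≡n∸∣p∣; p⊆q⇒∣p∣≤∣q∣; p⊆p∪q; q⊆p∪q
        ; x∈⁅x⁆; x∈∁p⇒x∉p; x∉p⇒x∈∁p; x∈p∧x≢y⇒x∈p-y; x∈p⇒∣p-x∣<∣p∣ )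
open import Data.Vec using ([]; _∷_; insertAt)
open import Data.Vec.Properties using (insertAt-lookup; insertAt-punchIn; lookup⇒[]=; []=⇒lookup)
open import Data.Product using (∃; ∃₂; _×_; _,_; proj₁; proj₂)
open import Data.Sum using (_⊎_; inj₁; inj₂; swap)
open import Relation.Nullary using (¬_; yes; no; does; contradiction)
open import Relation.Nullary.Decidable using (_×-dec_; ¬?; decidable-stable)
open import Relation.Binary.PropositionalEquality
  using (_≡_; _≢_; refl; sym; trans; cong; subst; module ≡-Reasoning)
open import Algebra.Properties.Semiring.Sum +-*-semiring
  using (sum-syntax; sum-cong-≗; ∑-comm; ∑-distrib-+; *-distribˡ-sum; *-distribʳ-sum)

private
  variable
    n : ℕ

∣p∪q∣≤∣p∣+∣q∣ : (p q : Subset n) → ∣ p ∪ q ∣ ≤ ∣ p ∣ + ∣ q ∣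
∣p∪q∣≤∣p∣+∣q∣ []            []            = z≤n
∣p∪q∣≤∣p∣+∣q∣ (inside ∷ p)  (x ∷ q)       =
  s≤s (≤-trans (∣p∪q∣≤∣p∣+∣q∣ p q) (+-monoʳ-≤ ∣ p ∣ (∣p∣≤∣x∷p∣ x q)))
∣p∪q∣≤∣p∣+∣q∣ (outside ∷ p) (inside ∷ q)  =
  ≤-trans (s≤s (∣p∪q∣≤∣p∣+∣q∣ p q)) (≤-reflexive (sym (+-suc ∣ p ∣ ∣ q ∣)))
∣p∪q∣≤∣p∣+∣q∣ (outside ∷ p) (outside ∷ q) = ∣p∪q∣≤∣p∣+∣q∣ p q

missing : {p : Subset n} → ∣ p ∣ < n → ∃ λ x → x ∉ p
missing {n} {p} small with any? (λ x → ¬? (x ∈? p))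
... | yes found = found
... | no none   = contradiction full (<⇒≱ small)
  where
  full : n ≤ ∣ p ∣
  full = subst (_≤ ∣ p ∣) (∣⊤∣≡n n)
           (p⊆q⇒∣p∣≤∣q∣ {p = ⊤} (λ {x} _ → decidable-stable (x ∈? p) (λ x∉p → none (x , x∉p))))

missingTwo : {p : Subset n} → suc ∣ p ∣ < n → ∃₂ λ x y → x ∉ p × y ∉ p × x ≢ y
missingTwo {n} {p} small with missing (<-trans (n<1+n ∣ p ∣) small)
... | x , x∉p with missing {p = p ∪ ⁅ x ⁆} (≤-<-trans withX small)
  where
  withX : ∣ p ∪ ⁅ x ⁆ ∣ ≤ suc ∣ p ∣
  withX = ≤-trans (∣p∪q∣≤∣p∣+∣q∣ p ⁅ x ⁆)
            (≤-reflexive (trans (cong (∣ p ∣ +_) (∣⁅x⁆∣≡1 x)) (+-comm ∣ p ∣ 1)))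
... | y , y∉p∪x =
  x , y , x∉p , (λ y∈p → y∉p∪x (p⊆p∪q ⁅ x ⁆ y∈p)) , λ { refl → y∉p∪x (q⊆p∪q p ⁅ x ⁆ (x∈⁅x⁆ x)) }

𝟙 : Subset n → Fin n → ℕ
𝟙 p x = if does (x ∈? p) then 1 else 0

∣p∣≡∑𝟙 : (p : Subset n) → ∣ p ∣ ≡ ∑[ x < n ] 𝟙 p x
∣p∣≡∑𝟙 []            = refl
∣p∣≡∑𝟙 (inside ∷ p)  = cong suc (∣p∣≡∑𝟙 p)
∣p∣≡∑𝟙 (outside ∷ p) = ∣p∣≡∑𝟙 p

∑-mono-≤ : {f g : Fin n → ℕ} → (∀ i → f i ≤ g i) → ∑[ i < n ] f i ≤ ∑[ i < n ] g i
∑-mono-≤ {zero}  f≤g = z≤n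
∑-mono-≤ {suc n} f≤g = +-mono-≤ (f≤g zero) (∑-mono-≤ (λ i → f≤g (suc i)))

∑-weighted-≤ : (k : ℕ) (w g : Fin n → ℕ) → (∀ i → g i ≤ k) →
  ∑[ i < n ] (w i * g i) ≤ (∑[ i < n ] w i) * k
∑-weighted-≤ {n} k w g g≤k = begin
  ∑[ i < n ] (w i * g i) ≤⟨ ∑-mono-≤ (λ i → *-monoʳ-≤ (w i) (g≤k i)) ⟩
  ∑[ i < n ] (w i * k)   ≡⟨ sym (*-distribʳ-sum k w) ⟩
  (∑[ i < n ] w i) * k   ∎
  where open ≤-Reasoning

-- Otherwise every ordered pair
-- of A is covered by a successor relation, so ∣A∣² ≤ 2k∣A∣.
mutuallyOutside : (k : ℕ) (K : Fin n → Subset n) (A : Subset n) →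
  (∀ u → ∣ K u ∣ ≤ k) → k + k < ∣ A ∣ →
  ∃₂ λ u v → u ∈ A × v ∈ A × v ∉ K u × u ∉ K v
mutuallyOutside {n} k K A small large
  with any? (λ u → any? (λ v → (u ∈? A) ×-dec (v ∈? A) ×-dec ¬? (v ∈? K u) ×-dec ¬? (u ∈? K v)))
... | yes found = found
... | no none   = contradiction (*-cancelˡ-≤ ∣ A ∣ {{>-nonZero (≤-<-trans z≤n large)}} squareBound)
                                (<⇒≱ large)
  where
  covered : ∀ u v → 𝟙 A u * 𝟙 A v ≤ 𝟙 A u * 𝟙 (K u) v + 𝟙 A v * 𝟙 (K v) u
  covered u v with u ∈? A | v ∈? A | v ∈? K u | u ∈? K v
  ... | no _    | _       | _       | _       = z≤n
  ... | yes _   | no _    | _       | _       = z≤n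
  ... | yes _   | yes _   | yes _   | _       = s≤s z≤n
  ... | yes _   | yes _   | no _    | yes _   = s≤s z≤n
  ... | yes u∈A | yes v∈A | no v∉Ku | no u∉Kv = contradiction (u , v , u∈A , v∈A , v∉Ku , u∉Kv) none

  successorPairs : ∑[ u < n ] ∑[ v < n ] (𝟙 A u * 𝟙 (K u) v) ≤ ∣ A ∣ * k
  successorPairs = begin
    ∑[ u < n ] ∑[ v < n ] (𝟙 A u * 𝟙 (K u) v) ≡⟨ sum-cong-≗ (λ u → sym (*-distribˡ-sum (𝟙 A u) (𝟙 (K u)))) ⟩
    ∑[ u < n ] (𝟙 A u * ∑[ v < n ] 𝟙 (K u) v) ≡⟨ sum-cong-≗ (λ u → cong (𝟙 A u *_) (sym (∣p∣≡∑𝟙 (K u)))) ⟩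
    ∑[ u < n ] (𝟙 A u * ∣ K u ∣)              ≤⟨ ∑-weighted-≤ k (𝟙 A) (λ u → ∣ K u ∣) small ⟩
    (∑[ u < n ] 𝟙 A u) * k                    ≡⟨ cong (_* k) (sym (∣p∣≡∑𝟙 A)) ⟩
    ∣ A ∣ * k                                 ∎
    where open ≤-Reasoning

  squareBound : ∣ A ∣ * ∣ A ∣ ≤ ∣ A ∣ * (k + k)
  squareBound = begin
    ∣ A ∣ * ∣ A ∣
      ≡⟨ cong (_* ∣ A ∣) (∣p∣≡∑𝟙 A) ⟩
    (∑[ u < n ] 𝟙 A u) * ∣ A ∣
      ≡⟨ *-distribʳ-sum ∣ A ∣ (𝟙 A) ⟩
    ∑[ u < n ] (𝟙 A u * ∣ A ∣)
      ≡⟨ sum-cong-≗ (λ u → trans (cong (𝟙 A u *_) (∣p∣≡∑𝟙 A)) (*-distribˡ-sum (𝟙 A u) (𝟙 A))) ⟩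
    ∑[ u < n ] ∑[ v < n ] (𝟙 A u * 𝟙 A v)
      ≤⟨ ∑-mono-≤ (λ u → ∑-mono-≤ (covered u)) ⟩
    ∑[ u < n ] ∑[ v < n ] (𝟙 A u * 𝟙 (K u) v + 𝟙 A v * 𝟙 (K v) u)
      ≡⟨ sum-cong-≗ (λ u → ∑-distrib-+ (λ v → 𝟙 A u * 𝟙 (K u) v) (λ v → 𝟙 A v * 𝟙 (K v) u)) ⟩
    ∑[ u < n ] (∑[ v < n ] (𝟙 A u * 𝟙 (K u) v) + ∑[ v < n ] (𝟙 A v * 𝟙 (K v) u))
      ≡⟨ ∑-distrib-+ (λ u → ∑[ v < n ] (𝟙 A u * 𝟙 (K u) v)) (λ u → ∑[ v < n ] (𝟙 A v * 𝟙 (K v) u)) ⟩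
    ∑[ u < n ] ∑[ v < n ] (𝟙 A u * 𝟙 (K u) v) + ∑[ u < n ] ∑[ v < n ] (𝟙 A v * 𝟙 (K v) u)
      ≡⟨ cong (∑[ u < n ] ∑[ v < n ] (𝟙 A u * 𝟙 (K u) v) +_) (∑-comm (λ u v → 𝟙 A v * 𝟙 (K v) u)) ⟩
    ∑[ u < n ] ∑[ v < n ] (𝟙 A u * 𝟙 (K u) v) + ∑[ v < n ] ∑[ u < n ] (𝟙 A v * 𝟙 (K v) u)
      ≤⟨ +-mono-≤ successorPairs successorPairs ⟩
    ∣ A ∣ * k + ∣ A ∣ * k
      ≡⟨ sym (*-distribˡ-+ ∣ A ∣ k k) ⟩
    ∣ A ∣ * (k + k) ∎
    where open ≤-Reasoning

complementLarge : {k : ℕ} (p : Subset n) → ∣ p ∣ ≤ k → k + k + k < n → k + k < ∣ ∁ p ∣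
complementLarge {n} {k} p p≤k large = +-cancelʳ-< k (k + k) ∣ ∁ p ∣ (begin-strict
  k + k + k         <⟨ large ⟩
  n                 ≡⟨ sym (m∸n+n≡m (∣p∣≤n p)) ⟩
  n ∸ ∣ p ∣ + ∣ p ∣ ≡⟨ cong (_+ ∣ p ∣) (sym (∣∁p∣≡n∸∣p∣ p)) ⟩
  ∣ ∁ p ∣ + ∣ p ∣   ≤⟨ +-monoʳ-≤ ∣ ∁ p ∣ p≤k ⟩
  ∣ ∁ p ∣ + k       ∎)
  where open ≤-Reasoning

∣p∪q∪r∣≤3k : {k : ℕ} (p q r : Subset n) → ∣ p ∣ ≤ k → ∣ q ∣ ≤ k → ∣ r ∣ ≤ k → ∣ p ∪ q ∪ r ∣ ≤ k + k + k
∣p∪q∪r∣≤3k {k = k} p q r p≤k q≤k r≤k = begin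
  ∣ p ∪ q ∪ r ∣           ≤⟨ ∣p∪q∣≤∣p∣+∣q∣ p (q ∪ r) ⟩
  ∣ p ∣ + ∣ q ∪ r ∣       ≤⟨ +-monoʳ-≤ ∣ p ∣ (∣p∪q∣≤∣p∣+∣q∣ q r) ⟩
  ∣ p ∣ + (∣ q ∣ + ∣ r ∣) ≤⟨ +-mono-≤ p≤k (+-mono-≤ q≤k r≤k) ⟩
  k + (k + k)             ≡⟨ sym (+-assoc k k k) ⟩
  k + k + k               ∎
  where open ≤-Reasoning

Uniform : Graph n → (Fin n → Set) → Fin n → Set
Uniform G P y = ∀ {a b} → P a → P b → a ≢ y → b ≢ y → adj G y a ≡ adj G y b

crown⇒uniform : {G : Graph n} {X : Subset n} → IsCrown G X → ∀ y → Uniform G (_∈ X) y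
crown⇒uniform crown y ha hb a≢y b≢y with crown y
... | inj₁ allAdjacent = trans (allAdjacent _ ha a≢y) (sym (allAdjacent _ hb b≢y))
... | inj₂ noneAdjacent = trans (noneAdjacent _ ha a≢y) (sym (noneAdjacent _ hb b≢y))

uniform⇒crown : (G : Graph n) (X : Subset n) → (∀ y → Uniform G (_∈ X) y) → IsCrown G X
uniform⇒crown G X uniform y with any? (λ a → (a ∈? X) ×-dec ¬? (a ≟ y))
... | no none = inj₁ (λ x x∈X x≢y → contradiction (x , x∈X , x≢y) none)
... | yes (a , a∈X , a≢y) with adj G y a in ya
...   | true  = inj₁ (λ x x∈X x≢y → trans (uniform y x∈X a∈X x≢y a≢y) ya)
...   | false = inj₂ (λ x x∈X x≢y → trans (uniform y x∈X a∈X x≢y a≢y) ya)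

punchIn-onto : {u y : Fin (suc n)} → u ≢ y → ∃ λ y′ → punchIn u y′ ≡ y
punchIn-onto u≢y = punchOut u≢y , punchIn-punchOut u≢y

-- The closed core of a core S of G ∖ u: S re-embedded into V(G), together with u itself.
closedCore : Fin (suc n) → Subset n → Subset (suc n)
closedCore u S = insertAt S u inside

∣closedCore∣ : (u : Fin (suc n)) (S : Subset n) → ∣ closedCore u S ∣ ≡ suc ∣ S ∣
∣closedCore∣ zero    S             = refl
∣closedCore∣ (suc u) (inside ∷ S)  = cong suc (∣closedCore∣ u S)
∣closedCore∣ (suc u) (outside ∷ S) = ∣closedCore∣ u S

u∈closedCore : (u : Fin (suc n)) (S : Subset n) → u ∈ closedCore u S
u∈closedCore u S = lookup⇒[]= u (closedCore u S) (insertAt-lookup S u inside)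

outsideClosedCore : {u a : Fin (suc n)} (S : Subset n) → a ∉ closedCore u S →
  ∃ λ a′ → punchIn u a′ ≡ a × a′ ∉ S
outsideClosedCore {u = u} {a} S a∉K with punchIn-onto {u = u} {a} (λ { refl → a∉K (u∈closedCore u S) })
... | a′ , refl = a′ , refl , λ a′∈S →
  a∉K (lookup⇒[]= (punchIn u a′) (closedCore u S) (trans (insertAt-punchIn S u inside a′) ([]=⇒lookup a′∈S)))

closedCoreUniform : (G : Graph (suc n)) (u : Fin (suc n)) (S : Subset n) →
  IsCore (deleteVertex G u) S → ∀ y → y ≢ u → Uniform G (_∉ closedCore u S) y
closedCoreUniform G u S crown y y≢u a∉K b∉K a≢y b≢y
  with punchIn-onto (λ u≡y → y≢u (sym u≡y)) | outsideClosedCore S a∉K | outsideClosedCore S b∉K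
... | y′ , refl | a′ , refl , a′∉S | b′ , refl , b′∉S =
  crown⇒uniform {G = deleteVertex G u} crown y′ (x∉p⇒x∈∁p a′∉S) (x∉p⇒x∈∁p b′∉S)
    (λ a′≡y′ → a≢y (cong (punchIn u) a′≡y′)) (λ b′≡y′ → b≢y (cong (punchIn u) b′≡y′))

record ClosedCores (s : ℕ) (G : Graph n) : Set where
  field
    K       : Fin n → Subset n
    self    : ∀ u → u ∈ K u
    small   : ∀ u → ∣ K u ∣ ≤ suc s
    uniform : ∀ u y → y ≢ u → Uniform G (_∉ K u) y

deletionStars⇒closedCores : ∀ {n} (s : ℕ) (G : Graph (suc n)) → EveryDeletionStar s G → ClosedCores s G
deletionStars⇒closedCores {n} s G stars = record
  { K       = λ u → closedCore u (core u)
  ; self    = λ u → u∈closedCore u (core u)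
  ; small   = λ u → subst (_≤ suc s) (sym (∣closedCore∣ u (core u))) (s≤s (coreSmall u))
  ; uniform = λ u → closedCoreUniform G u (core u) (isCore u)
  }
  where
  core : Fin (suc n) → Subset n
  core u = proj₁ (stars u)
  coreSmall : ∀ u → ∣ core u ∣ ≤ s
  coreSmall u = proj₁ (proj₂ (stars u))
  isCore : ∀ u → IsCore (deleteVertex G u) (core u)
  isCore u = proj₂ (proj₂ (stars u))

module _ {s : ℕ} {G : Graph n} (cc : ClosedCores s G) where
  open ClosedCores cc

  outside⇒≢ : ∀ {x z} → x ∉ K z → x ≢ z
  outside⇒≢ x∉Kz refl = x∉Kz (self _)

  -- The only delicate case,
  -- a ∈ K q with a ≠ q, goes around the cycle p, a, r, r₂ using the uniformity of the
  -- complements of K q (at a and at r) and of K p (at r).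
  pivot : ∀ {p q w r r₂} → p ∉ K q → p ∉ K w → q ∉ K w →
    r ∉ K p → r ∉ K q → r ∉ K w → r₂ ∉ K p → r₂ ∉ K q → r₂ ≢ r →
    ∀ {a} → a ∉ K p ⊎ a ∉ K q → a ≢ p → adj G p a ≡ adj G p r
  pivot {p} {q} {w} {r} {r₂} p∉Kq p∉Kw q∉Kw r∉Kp r∉Kq r∉Kw r₂∉Kp r₂∉Kq r₂≢r {a} a∉ a≢p
    with a ∈? K q
  ... | no a∉Kq = uniform q p (outside⇒≢ p∉Kq) a∉Kq r∉Kq a≢p (outside⇒≢ r∉Kp)
  ... | yes a∈Kq with a∉
  ...   | inj₂ a∉Kq = contradiction a∈Kq a∉Kq
  ...   | inj₁ a∉Kp with a ≟ q
  ...     | yes refl = uniform w p (outside⇒≢ p∉Kw) q∉Kw r∉Kw a≢p (outside⇒≢ r∉Kp)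
  ...     | no a≢q = begin
    adj G p a  ≡⟨ adj-sym G p a ⟩
    adj G a p  ≡⟨ uniform q a a≢q p∉Kq r∉Kq p≢a r≢a ⟩
    adj G a r  ≡⟨ adj-sym G a r ⟩
    adj G r a  ≡⟨ uniform p r (outside⇒≢ r∉Kp) a∉Kp r₂∉Kp (λ a≡r → r≢a (sym a≡r)) r₂≢r ⟩
    adj G r r₂ ≡⟨ uniform q r (outside⇒≢ r∉Kq) r₂∉Kq p∉Kq r₂≢r (λ p≡r → outside⇒≢ r∉Kp (sym p≡r)) ⟩
    adj G r p  ≡⟨ adj-sym G r p ⟩
    adj G p r  ∎
    where
    open ≡-Reasoning
    p≢a : p ≢ a
    p≢a p≡a = a≢p (sym p≡a)
    r≢a : r ≢ a
    r≢a refl = r∉Kq a∈Kq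

  module Configuration {u v w : Fin n}
    (v∉Ku : v ∉ K u) (u∉Kv : u ∉ K v) (u∉Kw : u ∉ K w) (v∉Kw : v ∉ K w) where

    Reference : Fin n → Set
    Reference r = r ∉ K u × r ∉ K v × r ∉ K w

    Outside : Fin n → Set
    Outside a = a ∉ K u ⊎ a ∉ K v

    seenAsReference : ∀ {r r₂} → Reference r → Reference r₂ → r₂ ≢ r →
      ∀ {x} → r ≢ x → ∀ {a} → Outside a → a ≢ x → adj G x a ≡ adj G x r
    seenAsReference (r∉Ku , r∉Kv , r∉Kw) (r₂∉Ku , r₂∉Kv , _) r₂≢r {x} r≢x a∉ a≢x
      with x ≟ u | x ≟ v
    ... | yes refl | _        = pivot u∉Kv u∉Kw v∉Kw r∉Ku r∉Kv r∉Kw r₂∉Ku r₂∉Kv r₂≢r a∉ a≢x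
    ... | no _     | yes refl = pivot v∉Ku v∉Kw u∉Kw r∉Kv r∉Ku r∉Kw r₂∉Kv r₂∉Ku r₂≢r (swap a∉) a≢x
    ... | no x≢u   | no x≢v with a∉
    ...   | inj₁ a∉Ku = uniform u x x≢u a∉Ku r∉Ku a≢x r≢x
    ...   | inj₂ a∉Kv = uniform v x x≢v a∉Kv r∉Kv a≢x r≢x

    uniformVia : ∀ {r r₂ x} → Reference r → Reference r₂ → r₂ ≢ r → r ≢ x → Uniform G Outside x
    uniformVia refR refR₂ r₂≢r r≢x a∉ b∉ a≢x b≢x =
      trans (seenAsReference refR refR₂ r₂≢r r≢x a∉ a≢x)
            (sym (seenAsReference refR refR₂ r₂≢r r≢x b∉ b≢x))

    unionUniform : ∀ {c d} → Reference c → Reference d → c ≢ d → ∀ x → Uniform G Outside x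
    unionUniform {c} refC refD c≢d x with c ≟ x
    ... | yes refl = uniformVia refD refC c≢d (λ d≡c → c≢d (sym d≡c))
    ... | no c≢x   = uniformVia refC refD (λ d≡c → c≢d (sym d≡c)) c≢x

    -- Hence K u ∖ {u}, which has at most s vertices, is a core of G: its complement lies
    -- outside K u or (being u itself) outside K v.
    star : ∀ {c d} → Reference c → Reference d → c ≢ d → IsStar s G
    star refC refD c≢d = K u - u , coreSmall , uniform⇒crown G (∁ (K u - u)) crownUniform
      where
      coreSmall : ∣ K u - u ∣ ≤ s
      coreSmall = ≤-pred (≤-trans (x∈p⇒∣p-x∣<∣p∣ (self u)) (small u))
      outsideUnion : ∀ {a} → a ∈ ∁ (K u - u) → Outside a
      outsideUnion {a} a∈ with a ≟ u
      ... | yes refl = inj₂ u∉Kv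
      ... | no a≢u   = inj₁ (λ a∈Ku → x∈∁p⇒x∉p a∈ (x∈p∧x≢y⇒x∈p-y a∈Ku a≢u))
      crownUniform : ∀ y → Uniform G (_∈ ∁ (K u - u)) y
      crownUniform y a∈ b∈ = unionUniform refC refD c≢d y (outsideUnion a∈) (outsideUnion b∈)

  -- With at least 3s + 5 vertices a configuration exists: a vertex w has more than 2(s + 1)
  -- vertices outside K w, two of which are outside each other's closed cores by double
  -- counting; and at most 3(s + 1) vertices lie in the three closed cores involved.
  closedCores⇒star : Fin n → suc (suc s + suc s + suc s) < n → IsStar s G
  closedCores⇒star w large
    with mutuallyOutside (suc s) K (∁ (K w)) small
           (complementLarge (K w) (small w) (<-trans (n<1+n _) large))
  ... | u , v , u∈Cw , v∈Cw , v∉Ku , u∉Kv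
    with missingTwo {p = K u ∪ K v ∪ K w}
           (≤-<-trans (s≤s (∣p∪q∪r∣≤3k (K u) (K v) (K w) (small u) (small v) (small w))) large)
  ... | c , d , c∉ , d∉ , c≢d = star (reference c∉) (reference d∉) c≢d
    where
    open Configuration v∉Ku u∉Kv (x∈∁p⇒x∉p u∈Cw) (x∈∁p⇒x∉p v∈Cw)
    reference : ∀ {r} → r ∉ K u ∪ K v ∪ K w → Reference r
    reference r∉ = (λ r∈ → r∉ (p⊆p∪q (K v ∪ K w) r∈))
                 , (λ r∈ → r∉ (q⊆p∪q (K u) (K v ∪ K w) (p⊆p∪q (K w) r∈)))
                 , (λ r∈ → r∉ (q⊆p∪q (K u) (K v ∪ K w) (q⊆p∪q (K v) (K w) r∈)))

3s+4≡3[s+1]+1 : ∀ s → 3 * s + 4 ≡ suc (suc s + suc s + suc s)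
3s+4≡3[s+1]+1 = solve-∀

vertexBound : (s n : ℕ) (G : Graph n) → ¬ IsStar s G → EveryDeletionStar s G → n ≤ 3 * s + 4
vertexBound s zero    G notStar stars = z≤n
vertexBound s (suc m) G notStar stars = ≮⇒≥ λ large →
  notStar (closedCores⇒star (deletionStars⇒closedCores s G stars) zero
                            (subst (_< suc m) (3s+4≡3[s+1]+1 s) large))

lemma4p1 : (s n : ℕ) (G : Graph n) → ¬ IsStar s G → EveryDeletionStar s G →
    n ≤ 4 * s + 5
lemma4p1 s n G notStar stars = ≤-trans (vertexBound s n G notStar stars) weaken
  where
  weaken : 3 * s + 4 ≤ 4 * s + 5
  weaken = +-mono-≤ (*-monoˡ-≤ s (n≤1+n 3)) (n≤1+n 4)
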